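{- Consider the online fractional admission control problem and the weight-augmentation procedure described in the context, run on an instance in which every request cost satisfies $1 \le p_i \le g$, and let $\alpha>0$ be the cost of an optimal fractional solution. Then the total number of weight augmentations performed during the whole run of the procedure is $O(\alpha \log (gc))$.
   Context: Instance: a directed graph $G=(V,E)$ with $|E|=m$, each edge $e$ having an integer capacity $c_e>0$, and $c=\max_{e\in E} c_e$. Requests $r_1,r_2,\ldots$ arrive online; each request $r_i$ is a simple path in $G$ and has a cost $p_i>0$. Fractional solutions: each request $r_i$ gets a weight $f_i\ge 0$ (the rejected fraction). At any time, $REQ_e$ is the set of requests that have arrived so far whose path contains $e$, $REQ=\bigcup_e REQ_e$, $ALIVE_e=\{i\in REQ_e : f_i<1\}$ and $n_e=|ALIVE_e|-c_e$. A fractional solution must satisfy $\sum_{i\in ALIVE_e} f_i \ge n_e$ for every edge $e$; its cost is $\sum_{i\in REQ}\min\{f_i,1\}p_i$. An optimal (offline) fractional solution on the whole request sequence is given by values $f^*_i\in[0,1]$ with $\sum_{i\in REQ_e} f^*_i \ge |REQ_e|-c_e$ for all $e$, minimizing $\sum_i f^*_i p_i$; $\alpha$ denotes its cost. Weight-augmentation procedure: initially $f_i=0$ for all requests (weights only increase). When request $r_i$ arrives, update $REQ_e, ALIVE_e, n_e$, and then for each edge $e$ of the path of $r_i$ (in arbitrary order): while $\sum_{i\in ALIVE_e} f_i < n_e$, perform a weight augmentation, consisting of: (a) for each $i\in ALIVE_e$ with $f_i=0$, set $f_i=1/(gc)$; (b) for each $i\in ALIVE_e$, set $f_i\gets f_i\bigl(1+\frac{1}{n_e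 p_i}\bigr)$; (c) update $ALIVE_e$ and $n_e$. -}

module Defs where

open import Data.Nat as ℕ using (ℕ; zero; suc; _⊔_)
open import Data.Nat.Logarithm using (⌊log₂_⌋)
open import Data.Integer as ℤ using (ℤ; +_)
open import Data.Rational as ℚ using (ℚ; 0ℚ; 1ℚ; _/_; 1/_; ≢-nonZero; ceiling)
open import Data.Rational.Properties using (_≟_; _<?_)
open import Data.Fin as Fin using (Fin)
open import Data.List using (List; []; _∷_; map; foldr; length; filter; allFin; _++_; [_])
open import Data.List.Relation.Unary.Unique.Propositional using (Unique)
open import Data.List.Relation.Binary.Permutation.Propositional using (_↭_)
open import Data.List.Membership.Propositional using (_∈_)
open import Data.Bool using (Bool; true; false; _∧_; if_then_else_)
open import Data.Product using (_×_; _,_; proj₁; proj₂; Σ)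
open import Relation.Nullary using (¬_; does; yes; no)
open import Relation.Binary.PropositionalEquality using (_≡_)

record Graph : Set where
  field
    nV  : ℕ
    m   : ℕ
    src : Fin m → Fin nV
    tgt : Fin m → Fin nV
open Graph public

Consecutive : (G : Graph) → List (Fin (m G)) → Set
Consecutive G []           = Data.Unit.⊤ where import Data.Unit
Consecutive G (e ∷ [])     = Data.Unit.⊤ where import Data.Unit
Consecutive G (e ∷ e′ ∷ es) = (tgt G e ≡ src G e′) × Consecutive G (e′ ∷ es)

vertices : (G : Graph) → List (Fin (m G)) → List (Fin (nV G))
vertices G []       = []
vertices G (e ∷ es) = src G e ∷ map (tgt G) (e ∷ es)

SimplePath : (G : Graph) → List (Fin (m G)) → Set
SimplePath G es = Consecutive G es × Unique (vertices G es)

maxCap : (G : Graph) → (Fin (m G) → ℕ) → ℕ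
maxCap G cap = foldr (λ e acc → cap e ⊔ acc) 0 (allFin (m G))

record Request (G : Graph) : Set where
  constructor req
  field
    path : List (Fin (m G))
    cost : ℚ
open Request public

_∈ᵇ_ : ∀ {k} → Fin k → List (Fin k) → Bool
e ∈ᵇ []       = false
e ∈ᵇ (x ∷ xs) = if does (e Fin.≟ x) then true else (e ∈ᵇ xs)

-- reciprocal, made total (1/0 := 0; never used at 0 by the algorithm)
inv : ℚ → ℚ
inv q with q ≟ 0ℚ
... | yes _  = 0ℚ
... | no q≢0 = 1/_ q {{≢-nonZero q≢0}}

ℕ→ℚ : ℕ → ℚ
ℕ→ℚ n = (+ n) / 1

ℤ→ℚ : ℤ → ℚ
ℤ→ℚ z = z / 1

-- State: the requests arrived so far, in order, each with its weight f_i
State : Graph → Set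
State G = List (Request G × ℚ)

sumℚ : List ℚ → ℚ
sumℚ = foldr ℚ._+_ 0ℚ

aliveᵇ : ∀ {G} → Fin (m G) → Request G × ℚ → Bool
aliveᵇ e (r , f) = (e ∈ᵇ path r) ∧ does (f <? 1ℚ)

ALIVE : ∀ {G} → Fin (m G) → State G → List (Request G × ℚ)
ALIVE e st = filter (λ x → Relation.Nullary.Decidable.Core.T? (aliveᵇ e x)) st
  where import Relation.Nullary.Decidable.Core

nₑ : ∀ {G} → (Fin (m G) → ℕ) → Fin (m G) → State G → ℤ
nₑ cap e st = (+ length (ALIVE e st)) ℤ.- (+ cap e)

aliveSum : ∀ {G} → Fin (m G) → State G → ℚ
aliveSum e st = sumℚ (map proj₂ (ALIVE e st))

Violated : ∀ {G} → (Fin (m G) → ℕ) → Fin (m G) → State G → Set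
Violated cap e st = aliveSum e st ℚ.< ℤ→ℚ (nₑ cap e st)

-- one weight augmentation on edge e, with parameter g.
-- ALIVE_e and n_e are those computed before the augmentation (step (c)
-- updates them only afterwards).
augment : ∀ {G} → (cap : Fin (m G) → ℕ) → (g : ℚ) → Fin (m G) → State G → State G
augment {G} cap g e st = map upd st
  where
    ne : ℚ
    ne = ℤ→ℚ (nₑ cap e st)
    start : ℚ
    start = inv (g ℚ.* ℕ→ℚ (maxCap G cap))
    upd : Request G × ℚ → Request G × ℚ
    upd (r , f) =
      if aliveᵇ e (r , f)
      then (r , (if does (f ≟ 0ℚ) then start else f) ℚ.* (1ℚ ℚ.+ inv (ne ℚ.* cost r)))
      else (r , f)

-- EdgeLoop cap g e st k st′ : the while loop on edge e, started in st,
-- performs exactly k weight augmentations and ends in st′.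
data EdgeLoop {G : Graph} (cap : Fin (m G) → ℕ) (g : ℚ) (e : Fin (m G))
     : State G → ℕ → State G → Set where
  stop : ∀ {st} → ¬ Violated cap e st → EdgeLoop cap g e st 0 st
  step : ∀ {st k st′} → Violated cap e st →
         EdgeLoop cap g e (augment cap g e st) k st′ →
         EdgeLoop cap g e st (suc k) st′

data EdgesLoop {G : Graph} (cap : Fin (m G) → ℕ) (g : ℚ)
     : List (Fin (m G)) → State G → ℕ → State G → Set where
  []  : ∀ {st} → EdgesLoop cap g [] st 0 st
  _∷_ : ∀ {e es st k st₁ l st₂} →
        EdgeLoop cap g e st k st₁ → EdgesLoop cap g es st₁ l st₂ →
        EdgesLoop cap g (e ∷ es) st (k ℕ.+ l) st₂

-- Run cap g rs st k st′ : processing the request sequence rs from state st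
-- (each new request gets f = 0; its edges are handled in an arbitrary order,
-- i.e. any permutation of its path) performs k augmentations in total.
data Run {G : Graph} (cap : Fin (m G) → ℕ) (g : ℚ)
     : List (Request G) → State G → ℕ → State G → Set where
  []  : ∀ {st} → Run cap g [] st 0 st
  arrive : ∀ {r rs st order k st₁ l st₂} →
        order ↭ path r →
        EdgesLoop cap g order (st ++ [ (r , 0ℚ) ]) k st₁ →
        Run cap g rs st₁ l st₂ →
        Run cap g (r ∷ rs) st (k ℕ.+ l) st₂

-- a fractional solution assigns f*_i to each request (list aligned with rs)
-- Σ_{i ∈ REQ_e} f*_i
reqSum : ∀ {G} → Fin (m G) → List (Request G) → List ℚ → ℚ
reqSum e []       _        = 0ℚ
reqSum e (_ ∷ _)  []       = 0ℚ
reqSum e (r ∷ rs) (f ∷ fs) = (if e ∈ᵇ path r then f else 0ℚ) ℚ.+ reqSum e rs fs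

reqCount : ∀ {G} → Fin (m G) → List (Request G) → ℕ
reqCount e []       = 0
reqCount e (r ∷ rs) = (if e ∈ᵇ path r then 1 else 0) ℕ.+ reqCount e rs

solCost : ∀ {G} → List (Request G) → List ℚ → ℚ
solCost []       _        = 0ℚ
solCost (_ ∷ _)  []       = 0ℚ
solCost (r ∷ rs) (f ∷ fs) = f ℚ.* cost r ℚ.+ solCost rs fs

data AllUnit : List ℚ → Set where
  []  : AllUnit []
  _∷_ : ∀ {f fs} → (0ℚ ℚ.≤ f × f ℚ.≤ 1ℚ) → AllUnit fs → AllUnit (f ∷ fs)

Feasible : ∀ {G} → (Fin (m G) → ℕ) → List (Request G) → List ℚ → Set
Feasible {G} cap rs fs =
  (length fs ≡ length rs) × AllUnit fs ×
  (∀ (e : Fin (m G)) → ℤ→ℚ ((+ reqCount e rs) ℤ.- (+ cap e)) ℚ.≤ reqSum e rs fs)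

Optimal : ∀ {G} → (Fin (m G) → ℕ) → List (Request G) → List ℚ → Set
Optimal cap rs fs = Feasible cap rs fs ×
  (∀ fs′ → Feasible cap rs fs′ → solCost rs fs ℚ.≤ solCost rs fs′)

-- the factor log(gc), taken as 1 + ⌊log₂ ⌈g·c⌉⌋ (≥ 1)
logFactor : ℚ → ℕ → ℕ
logFactor g c = suc ⌊log₂ ℤ.∣ ceiling (g ℚ.* ℕ→ℚ c) ∣ ⌋

module Submission where

-- Enrich each request by ghost data:
-- its value f* in the optimal solution and the total growth t = Σ y of the
-- increments y = 1/(n_e p) applied to its weight.  The potential
-- Ψ = Σ_i f*_i p_i t_i grows by Σ_{ALIVE_e} f*_i / n_e ≥ 1 with every
-- augmentation, because the optimum covers the violated edge
-- (Σ_{ALIVE_e} f*_i ≥ n_e).  On the other hand a weight started at 1/(gc) and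
-- multiplied by factors 1 + y, y ∈ [0,1], is at least (1/(gc))·2^(t/2), and it
-- stays below 2; hence t ≤ 2(L + 1) with L = logFactor g c and
-- Ψ ≤ α·2(L + 1) ≤ 4·α·L.

open import Defs
open import Data.Nat using (ℕ; _>_)
open import Data.Rational using (ℚ; _≤_; _<_; _*_; 0ℚ; 1ℚ)
open import Data.Fin using (Fin)
open import Data.List using (List; [])
open import Data.List.Relation.Unary.All using (All)
open import Data.Product using (Σ; _×_)

open import Data.Nat as ℕ using (zero; suc)
import Data.Fin as Fin
import Data.Nat.Properties as ℕ
open import Data.Nat.Logarithm using (⌊log₂_⌋; ⌊log₂⌋-mono-≤; ⌊log₂[2^n]⌋≡n)
import Data.Nat.Coprimality as Coprime
open import Data.Integer as ℤ using (ℤ)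
import Data.Integer.Properties as ℤ
import Data.Integer.DivMod as ℤ
open import Data.Integer.Tactic.RingSolver using () renaming (solve-∀ to ℤ-solve-∀)
open import Data.Rational as ℚ using (mkℚ; _+_; _-_; -_; toℚᵘ; *≤*; *<*; nonNegative; positive; ≢-nonZero)
open import Data.Rational.Properties
import Data.Rational.Unnormalised as ℚᵘ
import Data.Rational.Unnormalised.Properties as ℚᵘ
open import Data.List as List using (_∷_; map; filter; length; _++_; [_])
import Data.List.Properties as List
open import Data.List.Membership.Propositional using (_∈_)
open import Data.List.Membership.Propositional.Properties using (∈-allFin)
open import Data.List.Relation.Unary.Any using (here; there)
open import Data.List.Relation.Unary.All as All using ([]; _∷_)
import Data.List.Relation.Unary.All.Properties as All
open import Data.Bool using (Bool; true; false; if_then_else_; _∧_; T?)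
open import Data.Bool.Properties using (if-float)
open import Data.Product using (_,_; proj₁; proj₂)
open import Data.Sum using (_⊎_; inj₁; inj₂)
open import Data.Empty using (⊥; ⊥-elim)
open import Function using (_∘_)
open import Level using (0ℓ)
open import Relation.Nullary using (yes; no; does; Dec)
open import Relation.Nullary.Decidable using (dec⇒maybe)
open import Relation.Binary.PropositionalEquality hiding ([_])
open import Tactic.RingSolver using (solve-∀)
open import Tactic.RingSolver.Core.AlmostCommutativeRing using (AlmostCommutativeRing; fromCommutativeRing)

ℚ-ring : AlmostCommutativeRing 0ℓ 0ℓ
ℚ-ring = fromCommutativeRing +-*-commutativeRing (λ x → dec⇒maybe (0ℚ ≟ x))

ℤ→ℚ-as-fraction : ∀ z → toℚᵘ (ℤ→ℚ z) ≡ ℚᵘ.mkℚᵘ z 0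
ℤ→ℚ-as-fraction (ℤ.+ n)    = cong toℚᵘ (normalize-coprime {n} {0} (Coprime.sym (Coprime.1-coprimeTo n)))
ℤ→ℚ-as-fraction ℤ.-[1+ n ] = cong (λ q → toℚᵘ (- q)) (normalize-coprime {suc n} {0} (Coprime.sym (Coprime.1-coprimeTo (suc n))))

module _ where
  open import Relation.Binary.Reasoning.Setoid ℚᵘ.≃-setoid

  ℤ→ℚ-+ : ∀ a b → ℤ→ℚ (a ℤ.+ b) ≡ ℤ→ℚ a + ℤ→ℚ b
  ℤ→ℚ-+ a b = toℚᵘ-injective (begin
    toℚᵘ (ℤ→ℚ (a ℤ.+ b))              ≈⟨ ℚᵘ.≃-reflexive (ℤ→ℚ-as-fraction (a ℤ.+ b)) ⟩
    ℚᵘ.mkℚᵘ (a ℤ.+ b) 0               ≈⟨ ℚᵘ.*≡* (fraction-sum a b) ⟩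
    ℚᵘ.mkℚᵘ a 0 ℚᵘ.+ ℚᵘ.mkℚᵘ b 0       ≈⟨ ℚᵘ.≃-reflexive (sym (cong₂ ℚᵘ._+_ (ℤ→ℚ-as-fraction a) (ℤ→ℚ-as-fraction b))) ⟩
    toℚᵘ (ℤ→ℚ a) ℚᵘ.+ toℚᵘ (ℤ→ℚ b)     ≈⟨ ℚᵘ.≃-sym (toℚᵘ-homo-+ (ℤ→ℚ a) (ℤ→ℚ b)) ⟩
    toℚᵘ (ℤ→ℚ a + ℤ→ℚ b)              ∎)
    where
    fraction-sum : ∀ a b → (a ℤ.+ b) ℤ.* ℤ.+ 1 ≡ (a ℤ.* ℤ.+ 1 ℤ.+ b ℤ.* ℤ.+ 1) ℤ.* ℤ.+ 1
    fraction-sum = ℤ-solve-∀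

  ℤ→ℚ-* : ∀ a b → ℤ→ℚ (a ℤ.* b) ≡ ℤ→ℚ a * ℤ→ℚ b
  ℤ→ℚ-* a b = toℚᵘ-injective (begin
    toℚᵘ (ℤ→ℚ (a ℤ.* b))              ≈⟨ ℚᵘ.≃-reflexive (ℤ→ℚ-as-fraction (a ℤ.* b)) ⟩
    ℚᵘ.mkℚᵘ a 0 ℚᵘ.* ℚᵘ.mkℚᵘ b 0       ≈⟨ ℚᵘ.≃-reflexive (sym (cong₂ ℚᵘ._*_ (ℤ→ℚ-as-fraction a) (ℤ→ℚ-as-fraction b))) ⟩
    toℚᵘ (ℤ→ℚ a) ℚᵘ.* toℚᵘ (ℤ→ℚ b)     ≈⟨ ℚᵘ.≃-sym (toℚᵘ-homo-* (ℤ→ℚ a) (ℤ→ℚ b)) ⟩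
    toℚᵘ (ℤ→ℚ a * ℤ→ℚ b)              ∎)

  ℤ→ℚ-neg : ∀ a → ℤ→ℚ (ℤ.- a) ≡ - ℤ→ℚ a
  ℤ→ℚ-neg a = toℚᵘ-injective (begin
    toℚᵘ (ℤ→ℚ (ℤ.- a))                ≈⟨ ℚᵘ.≃-reflexive (ℤ→ℚ-as-fraction (ℤ.- a)) ⟩
    ℚᵘ.- ℚᵘ.mkℚᵘ a 0                  ≈⟨ ℚᵘ.≃-reflexive (sym (cong ℚᵘ.-_ (ℤ→ℚ-as-fraction a))) ⟩
    ℚᵘ.- toℚᵘ (ℤ→ℚ a)                 ≈⟨ ℚᵘ.≃-sym (toℚᵘ-homo‿- (ℤ→ℚ a)) ⟩
    toℚᵘ (- ℤ→ℚ a)                    ∎)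

ℤ→ℚ-mono-≤ : ∀ {a b} → a ℤ.≤ b → ℤ→ℚ a ≤ ℤ→ℚ b
ℤ→ℚ-mono-≤ {a} {b} a≤b = toℚᵘ-cancel-≤ (subst₂ ℚᵘ._≤_ (sym (ℤ→ℚ-as-fraction a)) (sym (ℤ→ℚ-as-fraction b))
  (ℚᵘ.*≤* (ℤ.*-monoʳ-≤-nonNeg (ℤ.+ 1) a≤b)))

ℤ→ℚ-mono-< : ∀ {a b} → a ℤ.< b → ℤ→ℚ a < ℤ→ℚ b
ℤ→ℚ-mono-< {a} {b} a<b = toℚᵘ-cancel-< (subst₂ ℚᵘ._<_ (sym (ℤ→ℚ-as-fraction a)) (sym (ℤ→ℚ-as-fraction b))
  (ℚᵘ.*<* (ℤ.*-monoʳ-<-pos (ℤ.+ 1) a<b)))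

ℤ→ℚ-cancel-≤ : ∀ {a b} → ℤ→ℚ a ≤ ℤ→ℚ b → a ℤ.≤ b
ℤ→ℚ-cancel-≤ {a} {b} h with subst₂ ℚᵘ._≤_ (ℤ→ℚ-as-fraction a) (ℤ→ℚ-as-fraction b) (toℚᵘ-mono-≤ h)
... | ℚᵘ.*≤* a≤b = ℤ.*-cancelʳ-≤-pos a b (ℤ.+ 1) a≤b

ℤ→ℚ-cancel-< : ∀ {a b} → ℤ→ℚ a < ℤ→ℚ b → a ℤ.< b
ℤ→ℚ-cancel-< {a} {b} h with subst₂ ℚᵘ._<_ (ℤ→ℚ-as-fraction a) (ℤ→ℚ-as-fraction b) (toℚᵘ-mono-< h)
... | ℚᵘ.*<* a<b = ℤ.*-cancelʳ-<-nonNeg (ℤ.+ 1) a<b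

ℤ→ℚ-pos⇒≥1 : ∀ z → 0ℚ < ℤ→ℚ z → 1ℚ ≤ ℤ→ℚ z
ℤ→ℚ-pos⇒≥1 z z>0 = ℤ→ℚ-mono-≤ (ℤ.i<j⇒suc[i]≤j (ℤ→ℚ-cancel-< {ℤ.+ 0} {z} z>0))

ℕ→ℚ-+ : ∀ a b → ℕ→ℚ (a ℕ.+ b) ≡ ℕ→ℚ a + ℕ→ℚ b
ℕ→ℚ-+ a b = ℤ→ℚ-+ (ℤ.+ a) (ℤ.+ b)

ℕ→ℚ-suc : ∀ n → ℕ→ℚ (suc n) ≡ 1ℚ + ℕ→ℚ n
ℕ→ℚ-suc = ℕ→ℚ-+ 1

ℕ→ℚ-* : ∀ a b → ℕ→ℚ (a ℕ.* b) ≡ ℕ→ℚ a * ℕ→ℚ b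
ℕ→ℚ-* a b = trans (cong ℤ→ℚ (ℤ.pos-* a b)) (ℤ→ℚ-* (ℤ.+ a) (ℤ.+ b))

ℕ→ℚ-minus : ∀ a b → ℤ→ℚ (ℤ.+ a ℤ.- ℤ.+ b) ≡ ℕ→ℚ a - ℕ→ℚ b
ℕ→ℚ-minus a b = trans (ℤ→ℚ-+ (ℤ.+ a) (ℤ.- ℤ.+ b)) (cong (λ y → ℕ→ℚ a + y) (ℤ→ℚ-neg (ℤ.+ b)))

ℕ→ℚ-mono-≤ : ∀ {a b} → a ℕ.≤ b → ℕ→ℚ a ≤ ℕ→ℚ b
ℕ→ℚ-mono-≤ a≤b = ℤ→ℚ-mono-≤ (ℤ.+≤+ a≤b)

ℕ→ℚ-nonNeg : ∀ n → 0ℚ ≤ ℕ→ℚ n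
ℕ→ℚ-nonNeg n = ℕ→ℚ-mono-≤ (ℕ.z≤n {n})

*-monoˡ-≤ : ∀ {a b c} → 0ℚ ≤ a → b ≤ c → a * b ≤ a * c
*-monoˡ-≤ {a} a≥0 = *-monoˡ-≤-nonNeg a {{nonNegative a≥0}}

*-monoʳ-≤ : ∀ {a b c} → 0ℚ ≤ a → b ≤ c → b * a ≤ c * a
*-monoʳ-≤ {a} a≥0 = *-monoʳ-≤-nonNeg a {{nonNegative a≥0}}

*-mono-≤ : ∀ {a b c d} → 0ℚ ≤ a → 0ℚ ≤ d → a ≤ b → c ≤ d → a * c ≤ b * d
*-mono-≤ a≥0 d≥0 a≤b c≤d = ≤-trans (*-monoˡ-≤ a≥0 c≤d) (*-monoʳ-≤ d≥0 a≤b)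

*-nonNeg : ∀ {a b} → 0ℚ ≤ a → 0ℚ ≤ b → 0ℚ ≤ a * b
*-nonNeg {a} a≥0 b≥0 = subst (_≤ a * _) (*-zeroʳ a) (*-monoˡ-≤ a≥0 b≥0)

+-nonNeg : ∀ {a b} → 0ℚ ≤ a → 0ℚ ≤ b → 0ℚ ≤ a + b
+-nonNeg = +-mono-≤

0≤1 : 0ℚ ≤ 1ℚ
0≤1 = *≤* (ℤ.+≤+ ℕ.z≤n)

≥1⇒>0 : ∀ {q} → 1ℚ ≤ q → 0ℚ < q
≥1⇒>0 = <-≤-trans (*<* (ℤ.+<+ (ℕ.s≤s ℕ.z≤n)))

diff-nonNeg : ∀ {a b} → a ≤ b → 0ℚ ≤ b - a
diff-nonNeg {a} {b} a≤b = subst (_≤ b - a) (+-inverseʳ a) (+-monoˡ-≤ (- a) a≤b)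

≤-by-gap : ∀ a b {d} → b - a ≡ d → 0ℚ ≤ d → a ≤ b
≤-by-gap a b b-a≡d d≥0 = subst₂ _≤_ (+-identityˡ a) (b-a+a≡b a b) (+-monoˡ-≤ a (subst (0ℚ ≤_) (sym b-a≡d) d≥0))
  where
  b-a+a≡b : ∀ a b → b - a + a ≡ b
  b-a+a≡b = solve-∀ ℚ-ring

inv-inverse : ∀ q → 0ℚ < q → inv q * q ≡ 1ℚ
inv-inverse q q>0 with q ≟ 0ℚ
... | yes q≡0 = ⊥-elim (<-irrefl (sym q≡0) q>0)
... | no q≢0 = *-inverseˡ q {{≢-nonZero q≢0}}

inv-pos : ∀ q → 0ℚ < q → 0ℚ < inv q
inv-pos q q>0 with q ≟ 0ℚ
... | yes q≡0 = ⊥-elim (<-irrefl (sym q≡0) q>0)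
... | no q≢0 = positive⁻¹ _ {{1/pos⇒pos q {{positive q>0}}}}

inv-≤1 : ∀ q → 1ℚ ≤ q → inv q ≤ 1ℚ
inv-≤1 q q≥1 = subst₂ _≤_ (*-identityʳ (inv q)) (inv-inverse q q>0) (*-monoˡ-≤ (<⇒≤ (inv-pos q q>0)) q≥1)
  where
  q>0 = ≥1⇒>0 q≥1

2ℚ : ℚ
2ℚ = 1ℚ + 1ℚ

0≤2 : 0ℚ ≤ 2ℚ
0≤2 = +-nonNeg 0≤1 0≤1

pow2 : ℕ → ℚ
pow2 L = ℕ→ℚ (2 ℕ.^ L)

pow2-suc : ∀ L → pow2 (suc L) ≡ 2ℚ * pow2 L
pow2-suc L = ℕ→ℚ-* 2 (2 ℕ.^ L)

pow2-nonNeg : ∀ L → 0ℚ ≤ pow2 L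
pow2-nonNeg L = ℕ→ℚ-nonNeg (2 ℕ.^ L)

-- `Dominates s b t` says  b ≥ s · h(t), where h is the piecewise linear
-- function with h(2L + r) = 2^L (1 + r/2) for L ∈ ℕ and r ∈ [0,2]; h
-- interpolates 2^(t/2).  A weight multiplied by factors 1 + y_j with
-- y_j ∈ [0,1] dominates h(Σ y_j), since h(t + x) ≤ (1 + x) h(t) for x ∈ [0,1].
record Dominates (s b t : ℚ) : Set where
  constructor dominating
  field
    bound : ∀ L r → 0ℚ ≤ r → r ≤ 2ℚ → 2ℚ * ℕ→ℚ L + r ≤ t → s * pow2 L * (2ℚ + r) ≤ 2ℚ * b
open Dominates

dominates-start : ∀ {s} → 0ℚ ≤ s → Dominates s s 0ℚ
dominates-start {s} s≥0 = dominating at-point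
  where
  at-point : ∀ L r → 0ℚ ≤ r → r ≤ 2ℚ → 2ℚ * ℕ→ℚ L + r ≤ 0ℚ → s * pow2 L * (2ℚ + r) ≤ 2ℚ * s
  at-point zero r r≥0 r≤2 r≤0 =
    subst₂ _≤_ (cong (_* (2ℚ + r)) (sym (*-identityʳ s))) (*-comm s 2ℚ)
      (*-monoˡ-≤ s≥0 (subst (2ℚ + r ≤_) (+-identityʳ 2ℚ) (+-monoʳ-≤ 2ℚ (subst (_≤ 0ℚ) (+-identityˡ r) r≤0))))
  at-point (suc L) r r≥0 r≤2 t≤0 = ⊥-elim (<-irrefl refl (<-≤-trans 0<t t≤0))
    where
    open ≤-Reasoning
    regroup : ∀ l r → 2ℚ + (2ℚ * l + r) ≡ 2ℚ * (1ℚ + l) + r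
    regroup = solve-∀ ℚ-ring
    0<t : 0ℚ < 2ℚ * ℕ→ℚ (suc L) + r
    0<t = begin-strict
      0ℚ                             <⟨ *<* (ℤ.+<+ (ℕ.s≤s ℕ.z≤n)) ⟩
      2ℚ                             ≡⟨ +-identityʳ 2ℚ ⟨
      2ℚ + 0ℚ                        ≤⟨ +-monoʳ-≤ 2ℚ (+-nonNeg (*-nonNeg 0≤2 (ℕ→ℚ-nonNeg L)) r≥0) ⟩
      2ℚ + (2ℚ * ℕ→ℚ L + r)          ≡⟨ regroup (ℕ→ℚ L) r ⟩
      2ℚ * (1ℚ + ℕ→ℚ L) + r          ≡⟨ cong (λ l → 2ℚ * l + r) (ℕ→ℚ-suc L) ⟨
      2ℚ * ℕ→ℚ (suc L) + r           ∎

dominates-mono : ∀ {s b b′ t} → b ≤ b′ → Dominates s b t → Dominates s b′ t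
dominates-mono b≤b′ dom = dominating λ L r r≥0 r≤2 below → ≤-trans (bound dom L r r≥0 r≤2 below) (*-monoˡ-≤ 0≤2 b≤b′)

-- To verify the bound at a point (L, r) after growth by x, it suffices to find
-- a point (L′, r′) below t, from which h grows by a factor at most 1 + x.
dominates-via : ∀ {s b t x L r} L′ r′ → 0ℚ ≤ s → 0ℚ ≤ x → Dominates s b t →
  0ℚ ≤ r′ → r′ ≤ 2ℚ → 2ℚ * ℕ→ℚ L′ + r′ ≤ t →
  pow2 L * (2ℚ + r) ≤ pow2 L′ * ((2ℚ + r′) * (1ℚ + x)) →
  s * pow2 L * (2ℚ + r) ≤ 2ℚ * (b * (1ℚ + x))
dominates-via {s} {b} {t} {x} {L} {r} L′ r′ s≥0 x≥0 dom r′≥0 r′≤2 below growth = begin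
  s * pow2 L * (2ℚ + r)                  ≡⟨ *-assoc s (pow2 L) (2ℚ + r) ⟩
  s * (pow2 L * (2ℚ + r))                ≤⟨ *-monoˡ-≤ s≥0 growth ⟩
  s * (pow2 L′ * ((2ℚ + r′) * (1ℚ + x))) ≡⟨ regroup s (pow2 L′) (2ℚ + r′) (1ℚ + x) ⟩
  s * pow2 L′ * (2ℚ + r′) * (1ℚ + x)     ≤⟨ *-monoʳ-≤ (+-nonNeg 0≤1 x≥0) (bound dom L′ r′ r′≥0 r′≤2 below) ⟩
  2ℚ * b * (1ℚ + x)                      ≡⟨ *-assoc 2ℚ b (1ℚ + x) ⟩
  2ℚ * (b * (1ℚ + x))                    ∎
  where
  open ≤-Reasoning
  regroup : ∀ a b c d → a * (b * (c * d)) ≡ a * b * c * d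
  regroup = solve-∀ ℚ-ring

≤-+⇒-≤ : ∀ {a t x} → a ≤ t + x → a - x ≤ t
≤-+⇒-≤ {a} {t} {x} a≤t+x = subst (a - x ≤_) (t+x-x≡t t x) (+-monoˡ-≤ (- x) a≤t+x)
  where
  t+x-x≡t : ∀ t x → t + x - x ≡ t
  t+x-x≡t = solve-∀ ℚ-ring

-- Given a target point 2L + r ≤ t + x,
-- we step back by x: within the same segment if x ≤ r, otherwise into the
-- previous segment (or to the origin when L = 0).
dominates-step : ∀ {s b t x} → 0ℚ ≤ s → 0ℚ ≤ t → 0ℚ ≤ x → x ≤ 1ℚ →
  Dominates s b t → Dominates s (b * (1ℚ + x)) (t + x)
dominates-step {s} {b} {t} {x} s≥0 t≥0 x≥0 x≤1 dom = dominating at-point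
  where
  at-point : ∀ L r → 0ℚ ≤ r → r ≤ 2ℚ → 2ℚ * ℕ→ℚ L + r ≤ t + x → s * pow2 L * (2ℚ + r) ≤ 2ℚ * (b * (1ℚ + x))
  at-point L r r≥0 r≤2 below with x ≤? r
  ... | yes x≤r = dominates-via {b = b} {L = L} {r = r} L (r - x) s≥0 x≥0 dom (diff-nonNeg x≤r) r-x≤2 below′
                    (*-monoˡ-≤ (pow2-nonNeg L) (≤-by-gap (2ℚ + r) ((2ℚ + (r - x)) * (1ℚ + x)) (gap r x) gap≥0))
    where
    r-[r-x]≡x : ∀ r x → r - (r - x) ≡ x
    r-[r-x]≡x = solve-∀ ℚ-ring
    r-x≤2 : r - x ≤ 2ℚ
    r-x≤2 = ≤-trans (≤-by-gap (r - x) r (r-[r-x]≡x r x) x≥0) r≤2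
    below′ : 2ℚ * ℕ→ℚ L + (r - x) ≤ t
    below′ = subst (_≤ t) (+-assoc (2ℚ * ℕ→ℚ L) r (- x)) (≤-+⇒-≤ below)
    gap : ∀ r x → (2ℚ + (r - x)) * (1ℚ + x) - (2ℚ + r) ≡ x * (1ℚ + (r - x))
    gap = solve-∀ ℚ-ring
    gap≥0 : 0ℚ ≤ x * (1ℚ + (r - x))
    gap≥0 = *-nonNeg x≥0 (+-nonNeg 0≤1 (diff-nonNeg x≤r))
  ... | no x≰r = previous-segment L below
    where
    r≤x : r ≤ x
    r≤x = <⇒≤ (≰⇒> x≰r)
    previous-segment : ∀ L → 2ℚ * ℕ→ℚ L + r ≤ t + x → s * pow2 L * (2ℚ + r) ≤ 2ℚ * (b * (1ℚ + x))
    previous-segment zero _ = dominates-via {b = b} {L = 0} {r = r} 0 0ℚ s≥0 x≥0 dom ≤-refl 0≤2 t≥0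
      (*-monoˡ-≤ (pow2-nonNeg 0) (≤-by-gap (2ℚ + r) ((2ℚ + 0ℚ) * (1ℚ + x)) (gap r x) gap≥0))
      where
      gap : ∀ r x → (2ℚ + 0ℚ) * (1ℚ + x) - (2ℚ + r) ≡ x + (x - r)
      gap = solve-∀ ℚ-ring
      gap≥0 : 0ℚ ≤ x + (x - r)
      gap≥0 = +-nonNeg x≥0 (diff-nonNeg r≤x)
    previous-segment (suc L′) below =
      dominates-via {b = b} {L = suc L′} {r = r} L′ (2ℚ + r - x) s≥0 x≥0 dom r′≥0 r′≤2 below′ growth
      where
      split : ∀ r x → (1ℚ - x) + (1ℚ + r) ≡ 2ℚ + r - x
      split = solve-∀ ℚ-ring
      r′≥0 : 0ℚ ≤ 2ℚ + r - x
      r′≥0 = subst (0ℚ ≤_) (split r x) (+-nonNeg (diff-nonNeg x≤1) (+-nonNeg 0≤1 r≥0))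
      r′≤2 : 2ℚ + r - x ≤ 2ℚ
      r′≤2 = ≤-by-gap (2ℚ + r - x) 2ℚ (gap r x) (diff-nonNeg r≤x)
        where
        gap : ∀ r x → 2ℚ - (2ℚ + r - x) ≡ x - r
        gap = solve-∀ ℚ-ring
      regroup : ∀ l r x → 2ℚ * (1ℚ + l) + r - x ≡ 2ℚ * l + (2ℚ + r - x)
      regroup = solve-∀ ℚ-ring
      below′ : 2ℚ * ℕ→ℚ L′ + (2ℚ + r - x) ≤ t
      below′ = subst (_≤ t) (regroup (ℕ→ℚ L′) r x)
                 (≤-+⇒-≤ (subst (λ l → 2ℚ * l + r ≤ t + x) (ℕ→ℚ-suc L′) below))
      gap : ∀ r x → (2ℚ + (2ℚ + r - x)) * (1ℚ + x) - 2ℚ * (2ℚ + r) ≡ (x - r) + x * (1ℚ - x) + x + r * x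
      gap = solve-∀ ℚ-ring
      gap≥0 : 0ℚ ≤ (x - r) + x * (1ℚ - x) + x + r * x
      gap≥0 = +-nonNeg (+-nonNeg (+-nonNeg (diff-nonNeg r≤x) (*-nonNeg x≥0 (diff-nonNeg x≤1))) x≥0) (*-nonNeg r≥0 x≥0)
      double : ∀ p u → p * (2ℚ * u) ≡ 2ℚ * p * u
      double = solve-∀ ℚ-ring
      growth : pow2 (suc L′) * (2ℚ + r) ≤ pow2 L′ * ((2ℚ + (2ℚ + r - x)) * (1ℚ + x))
      growth = subst (_≤ pow2 L′ * ((2ℚ + (2ℚ + r - x)) * (1ℚ + x)))
                 (trans (double (pow2 L′) (2ℚ + r)) (cong (_* (2ℚ + r)) (sym (pow2-suc L′))))
                 (*-monoˡ-≤ (pow2-nonNeg L′) (≤-by-gap (2ℚ * (2ℚ + r)) ((2ℚ + (2ℚ + r - x)) * (1ℚ + x)) (gap r x) gap≥0))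

-- A dominating weight of size at most 2 bounds the exponent: if s·2^K > 1
-- then t ≤ 2(K + 1), as otherwise b ≥ s·h(2(K+1)) = s·2^(K+1) > 2.
dominates-bound : ∀ {s b t} K → Dominates s b t → b ≤ 2ℚ → 1ℚ < s * pow2 K → t ≤ 2ℚ * ℕ→ℚ (suc K)
dominates-bound {s} {b} {t} K dom b≤2 big with t ≤? 2ℚ * ℕ→ℚ (suc K)
... | yes t≤T = t≤T
... | no t≰T = ⊥-elim (<-irrefl refl (<-≤-trans too-big at-most))
  where
  open ≤-Reasoning
  T = 2ℚ * ℕ→ℚ (suc K)
  4ℚ = 2ℚ * 2ℚ
  regroup : ∀ s p → 2ℚ * 2ℚ * (s * p) ≡ s * (2ℚ * p) * (2ℚ + 0ℚ)
  regroup = solve-∀ ℚ-ring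
  T+0≤t : T + 0ℚ ≤ t
  T+0≤t = subst (_≤ t) (sym (+-identityʳ T)) (<⇒≤ (≰⇒> t≰T))
  at-most : 4ℚ * (s * pow2 K) ≤ 4ℚ
  at-most = begin
    4ℚ * (s * pow2 K)                ≡⟨ regroup s (pow2 K) ⟩
    s * (2ℚ * pow2 K) * (2ℚ + 0ℚ)    ≡⟨ cong (λ p → s * p * (2ℚ + 0ℚ)) (pow2-suc K) ⟨
    s * pow2 (suc K) * (2ℚ + 0ℚ)     ≤⟨ bound dom (suc K) 0ℚ ≤-refl 0≤2 T+0≤t ⟩
    2ℚ * b                           ≤⟨ *-monoˡ-≤ 0≤2 b≤2 ⟩
    4ℚ                               ∎
  too-big : 4ℚ < 4ℚ * (s * pow2 K)
  too-big = subst (_< 4ℚ * (s * pow2 K)) (*-identityʳ 4ℚ) (*-monoʳ-<-pos 4ℚ big)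

floor-≤ : ∀ q → ℤ→ℚ (ℚ.floor q) ≤ q
floor-≤ (mkℚ n d _) = toℚᵘ-cancel-≤ (subst (ℚᵘ._≤ ℚᵘ.mkℚᵘ n d) (sym (ℤ→ℚ-as-fraction (n ℤ./ ℤ.+ suc d)))
  (ℚᵘ.*≤* (subst ((n ℤ./ ℤ.+ suc d) ℤ.* ℤ.+ suc d ℤ.≤_) (sym (ℤ.*-identityʳ n)) (ℤ.[n/d]*d≤n n (ℤ.+ suc d)))))

ceiling-≥ : ∀ q → q ≤ ℤ→ℚ (ℚ.ceiling q)
ceiling-≥ q@record{} = subst₂ _≤_ (neg-involutive q) (sym (ℤ→ℚ-neg (ℚ.floor (- q)))) (neg-antimono-≤ (floor-≤ (- q)))
  where
  neg-involutive : ∀ q → - (- q) ≡ q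
  neg-involutive = solve-∀ ℚ-ring

<2^suc⌊log₂⌋ : ∀ N → N ℕ.< 2 ℕ.^ suc ⌊log₂ N ⌋
<2^suc⌊log₂⌋ N with N ℕ.<? 2 ℕ.^ suc ⌊log₂ N ⌋
... | yes N<2^[1+k] = N<2^[1+k]
... | no N≮2^[1+k] = ⊥-elim (ℕ.n≮n ⌊log₂ N ⌋ (subst (ℕ._≤ ⌊log₂ N ⌋) (⌊log₂[2^n]⌋≡n (suc ⌊log₂ N ⌋))
                       (⌊log₂⌋-mono-≤ (ℕ.≮⇒≥ N≮2^[1+k]))))

<2^logFactor : ∀ g c → 0ℚ ≤ g * ℕ→ℚ c → g * ℕ→ℚ c < pow2 (logFactor g c)
<2^logFactor g c gc≥0 = begin-strict
  g * ℕ→ℚ c                         ≤⟨ ceiling-≥ (g * ℕ→ℚ c) ⟩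
  ℤ→ℚ ⌈gc⌉                          ≡⟨ cong ℤ→ℚ (ℤ.0≤i⇒+∣i∣≡i ⌈gc⌉≥0) ⟨
  ℕ→ℚ ℤ.∣ ⌈gc⌉ ∣                    <⟨ ℤ→ℚ-mono-< (ℤ.+<+ (<2^suc⌊log₂⌋ ℤ.∣ ⌈gc⌉ ∣)) ⟩
  pow2 (logFactor g c)              ∎
  where
  open ≤-Reasoning
  ⌈gc⌉ = ℚ.ceiling (g * ℕ→ℚ c)
  ⌈gc⌉≥0 : ℤ.+ 0 ℤ.≤ ⌈gc⌉
  ⌈gc⌉≥0 = ℤ→ℚ-cancel-≤ (≤-trans gc≥0 (ceiling-≥ (g * ℕ→ℚ c)))

sumOf : {A : Set} → (A → ℚ) → List A → ℚ
sumOf h []       = 0ℚ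
sumOf h (x ∷ xs) = h x + sumOf h xs

module _ {A : Set} where

  sumOf-+ : ∀ (h k : A → ℚ) xs → sumOf (λ x → h x + k x) xs ≡ sumOf h xs + sumOf k xs
  sumOf-+ h k []       = refl
  sumOf-+ h k (x ∷ xs) = trans (cong ((h x + k x) +_) (sumOf-+ h k xs)) (interchange (h x) (k x) (sumOf h xs) (sumOf k xs))
    where
    interchange : ∀ a b c d → a + b + (c + d) ≡ a + c + (b + d)
    interchange = solve-∀ ℚ-ring

  sumOf-- : ∀ (h k : A → ℚ) xs → sumOf (λ x → h x - k x) xs ≡ sumOf h xs - sumOf k xs
  sumOf-- h k []       = refl
  sumOf-- h k (x ∷ xs) = trans (cong ((h x - k x) +_) (sumOf-- h k xs)) (interchange (h x) (k x) (sumOf h xs) (sumOf k xs))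
    where
    interchange : ∀ a b c d → a - b + (c - d) ≡ a + c - (b + d)
    interchange = solve-∀ ℚ-ring

  sumOf-*ʳ : ∀ (h : A → ℚ) c xs → sumOf h xs * c ≡ sumOf (λ x → h x * c) xs
  sumOf-*ʳ h c []       = *-zeroˡ c
  sumOf-*ʳ h c (x ∷ xs) = trans (*-distribʳ-+ c (h x) (sumOf h xs)) (cong ((h x * c) +_) (sumOf-*ʳ h c xs))

  sumOf-mono : ∀ {h k : A → ℚ} {xs} → All (λ x → h x ≤ k x) xs → sumOf h xs ≤ sumOf k xs
  sumOf-mono []         = ≤-refl
  sumOf-mono (h≤k ∷ hs) = +-mono-≤ h≤k (sumOf-mono hs)

  sumOf-cong : ∀ {h k : A → ℚ} {xs} → All (λ x → h x ≡ k x) xs → sumOf h xs ≡ sumOf k xs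
  sumOf-cong []         = refl
  sumOf-cong (h≡k ∷ hs) = cong₂ _+_ h≡k (sumOf-cong hs)

  sumOf-++ : ∀ (h : A → ℚ) xs ys → sumOf h (xs ++ ys) ≡ sumOf h xs + sumOf h ys
  sumOf-++ h []       ys = sym (+-identityˡ (sumOf h ys))
  sumOf-++ h (x ∷ xs) ys = trans (cong ((h x) +_) (sumOf-++ h xs ys)) (sym (+-assoc (h x) (sumOf h xs) (sumOf h ys)))

  sumOf-map : ∀ {B : Set} (h : B → ℚ) (f : A → B) xs → sumOf h (map f xs) ≡ sumOf (h ∘ f) xs
  sumOf-map h f []       = refl
  sumOf-map h f (x ∷ xs) = cong ((h (f x)) +_) (sumOf-map h f xs)

  length-filter : ∀ (p : A → Bool) xs →
    ℕ→ℚ (length (filter (T? ∘ p) xs)) ≡ sumOf (λ x → if p x then 1ℚ else 0ℚ) xs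
  length-filter p []       = refl
  length-filter p (x ∷ xs) with p x
  ... | true  = trans (ℕ→ℚ-suc (length (filter (T? ∘ p) xs))) (cong (1ℚ +_) (length-filter p xs))
  ... | false = trans (length-filter p xs) (sym (+-identityˡ (sumOf (λ x → if p x then 1ℚ else 0ℚ) xs)))

sumℚ-nonNeg : ∀ {qs} → All (0ℚ ≤_) qs → 0ℚ ≤ sumℚ qs
sumℚ-nonNeg []           = ≤-refl
sumℚ-nonNeg (q≥0 ∷ qs≥0) = +-nonNeg q≥0 (sumℚ-nonNeg qs≥0)

gains-add : ∀ {a b c} k l → a + ℕ→ℚ k ≤ b → b + ℕ→ℚ l ≤ c → a + ℕ→ℚ (k ℕ.+ l) ≤ c
gains-add {a} {b} {c} k l a+k≤b b+l≤c = begin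
  a + ℕ→ℚ (k ℕ.+ l)        ≡⟨ cong (a +_) (ℕ→ℚ-+ k l) ⟩
  a + (ℕ→ℚ k + ℕ→ℚ l)      ≡⟨ +-assoc a (ℕ→ℚ k) (ℕ→ℚ l) ⟨
  a + ℕ→ℚ k + ℕ→ℚ l        ≤⟨ +-monoˡ-≤ (ℕ→ℚ l) a+k≤b ⟩
  b + ℕ→ℚ l                ≤⟨ b+l≤c ⟩
  c                        ∎
  where open ≤-Reasoning

reqSum≤reqCount : ∀ {G} (e : Fin (m G)) (rs : List (Request G)) fs → AllUnit fs → reqSum e rs fs ≤ ℕ→ℚ (reqCount e rs)
reqSum≤reqCount     e []       fs       _                  = ≤-refl
reqSum≤reqCount     e (r ∷ rs) []       _                  = ℕ→ℚ-nonNeg (reqCount e (r ∷ rs))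
reqSum≤reqCount {G} e (r ∷ rs) (f ∷ fs) ((_ , f≤1) ∷ unit) with e ∈ᵇ path r
... | true  = begin
  f + reqSum e rs fs          ≤⟨ +-mono-≤ f≤1 (reqSum≤reqCount {G} e rs fs unit) ⟩
  1ℚ + ℕ→ℚ (reqCount e rs)    ≡⟨ ℕ→ℚ-suc (reqCount e rs) ⟨
  ℕ→ℚ (suc (reqCount e rs))   ∎
  where open ≤-Reasoning
... | false = begin
  0ℚ + reqSum e rs fs         ≡⟨ +-identityˡ (reqSum e rs fs) ⟩
  reqSum e rs fs              ≤⟨ reqSum≤reqCount {G} e rs fs unit ⟩
  ℕ→ℚ (reqCount e rs)         ∎
  where open ≤-Reasoning

-- The procedure, run on states enriched by ghost data used only in the
-- analysis.  For the instance (G, cap, g) fixed below, w₀ = 1/(gc) is the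
-- weight a request receives at its first augmentation.
module Simulation (G : Graph) (cap : Fin (m G) → ℕ) (g : ℚ) where

  w₀ : ℚ
  w₀ = inv (g * ℕ→ℚ (maxCap G cap))

  -- A request with its weight f, the total growth Σ y of the increments
  -- y = 1/(n_e p) applied to it so far, and its value f* in the optimum.
  record Ghost : Set where
    constructor ghost
    field
      request : Request G
      weight  : ℚ
      growth  : ℚ
      opt     : ℚ
  open Ghost public

  erase : Ghost → Request G × ℚ
  erase x = request x , weight x

  -- the part of a ghost that augmentations never change
  skeleton : Ghost → Request G × ℚ
  skeleton x = request x , opt x

  alive : Fin (m G) → Ghost → Bool
  alive e x = aliveᵇ e (erase x)

  demand : Fin (m G) → List Ghost → ℚ
  demand e X = ℤ→ℚ (nₑ cap e (map erase X))

  increment : ℚ → Ghost → ℚ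
  increment n x = inv (n * cost (request x))

  seed : Ghost → ℚ
  seed x = if does (weight x ≟ 0ℚ) then w₀ else weight x

  bumpIf : Bool → ℚ → Ghost → Ghost
  bumpIf true  n x = ghost (request x) (seed x * (1ℚ + increment n x)) (growth x + increment n x) (opt x)
  bumpIf false n x = x

  augmentGhosts : Fin (m G) → List Ghost → List Ghost
  augmentGhosts e X = map (λ x → bumpIf (alive e x) (demand e X) x) X

  erase-bumpIf : ∀ b n x → erase (bumpIf b n x) ≡
    (if b then (request x , seed x * (1ℚ + increment n x)) else erase x)
  erase-bumpIf true  n x = refl
  erase-bumpIf false n x = refl

  erase-augment : ∀ e X → map erase (augmentGhosts e X) ≡ augment cap g e (map erase X)
  erase-augment e X = trans (sym (List.map-∘ X))
    (trans (List.map-cong (λ x → erase-bumpIf (alive e x) (demand e X) x) X) (List.map-∘ X))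

  skeleton-augment : ∀ e X → map skeleton (augmentGhosts e X) ≡ map skeleton X
  skeleton-augment e X = trans (sym (List.map-∘ X)) (List.map-cong (λ x → skeleton-bumpIf (alive e x) x) X)
    where
    skeleton-bumpIf : ∀ b x → skeleton (bumpIf b (demand e X) x) ≡ skeleton x
    skeleton-bumpIf true  x = refl
    skeleton-bumpIf false x = refl

  -- The potential Ψ = Σ_i f*_i p_i (Σ y): it grows by at least 1 per
  -- augmentation, and is at most α·T when every total growth is at most T.
  potential : Ghost → ℚ
  potential x = opt x * cost (request x) * growth x

  Ψ : List Ghost → ℚ
  Ψ = sumOf potential

  solCost-ghosts : ∀ X → solCost (map request X) (map opt X) ≡ sumOf (λ x → opt x * cost (request x)) X
  solCost-ghosts []      = refl
  solCost-ghosts (x ∷ X) = cong ((opt x * cost (request x)) +_) (solCost-ghosts X)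

  gain : Fin (m G) → ℚ → Ghost → ℚ
  gain e n x = if alive e x then opt x * cost (request x) * increment n x else 0ℚ

  Ψ-augment : ∀ e X → Ψ (augmentGhosts e X) ≡ Ψ X + sumOf (gain e (demand e X)) X
  Ψ-augment e X = begin
    Ψ (augmentGhosts e X)                                         ≡⟨ sumOf-map potential _ X ⟩
    sumOf (λ x → potential (bumpIf (alive e x) (demand e X) x)) X  ≡⟨ sumOf-cong (All.universal (λ x → potential-bumpIf (alive e x) x) X) ⟩
    sumOf (λ x → potential x + gain e (demand e X) x) X           ≡⟨ sumOf-+ potential (gain e (demand e X)) X ⟩
    Ψ X + sumOf (gain e (demand e X)) X                           ∎
    where
    open ≡-Reasoning
    potential-bumpIf : ∀ b x → potential (bumpIf b (demand e X) x) ≡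
      potential x + (if b then opt x * cost (request x) * increment (demand e X) x else 0ℚ)
    potential-bumpIf true  x = distrib (opt x * cost (request x)) (growth x) (increment (demand e X) x)
      where
      distrib : ∀ a t y → a * (t + y) ≡ a * t + a * y
      distrib = solve-∀ ℚ-ring
    potential-bumpIf false x = sym (+-identityʳ (potential x))

  record Sane (x : Ghost) : Set where
    field
      cost≥1   : 1ℚ ≤ cost (request x)
      opt≥0    : 0ℚ ≤ opt x
      opt≤1    : opt x ≤ 1ℚ
      weight≥0 : 0ℚ ≤ weight x
      weight≤2 : weight x ≤ 2ℚ
      growth≥0 : 0ℚ ≤ growth x
      tracked  : (weight x ≡ 0ℚ × growth x ≡ 0ℚ) ⊎ Dominates w₀ (weight x) (growth x)

  onPath : Fin (m G) → Request G × ℚ → ℚ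
  onPath e (r , _) = if e ∈ᵇ path r then 1ℚ else 0ℚ

  optOnPath : Fin (m G) → Request G × ℚ → ℚ
  optOnPath e (r , φ) = if e ∈ᵇ path r then φ else 0ℚ

  Covers : List (Request G × ℚ) → Set
  Covers S = ∀ e → sumOf (onPath e) S - ℕ→ℚ (cap e) ≤ sumOf (optOnPath e) S

  aliveCount : Fin (m G) → Ghost → ℚ
  aliveCount e x = if alive e x then 1ℚ else 0ℚ

  aliveOpt : Fin (m G) → Ghost → ℚ
  aliveOpt e x = if alive e x then opt x else 0ℚ

  demand-≡ : ∀ e X → demand e X ≡ sumOf (aliveCount e) X - ℕ→ℚ (cap e)
  demand-≡ e X = trans (ℕ→ℚ-minus (length (ALIVE e (map erase X))) (cap e))
    (cong (_- ℕ→ℚ (cap e)) (trans (length-filter (aliveᵇ e) (map erase X)) (sumOf-map _ erase X)))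

  -- a request on e that is not alive contributes f* ≤ 1 to the left and 1 to the right
  optOnPath-≤ : ∀ e x → Sane x → optOnPath e (skeleton x) ≤ aliveOpt e x + (onPath e (skeleton x) - aliveCount e x)
  optOnPath-≤ e x sx with e ∈ᵇ path (request x) | does (weight x <? 1ℚ)
  ... | true  | true  = subst (opt x ≤_) (sym (plus-zero (opt x))) ≤-refl
    where
    plus-zero : ∀ φ → φ + (1ℚ - 1ℚ) ≡ φ
    plus-zero = solve-∀ ℚ-ring
  ... | true  | false = Sane.opt≤1 sx
  ... | false | _     = ≤-refl

  demand≤aliveOpt : ∀ e X → Covers (map skeleton X) → All Sane X → demand e X ≤ sumOf (aliveOpt e) X
  demand≤aliveOpt e X covered sane = begin
    demand e X             ≡⟨ demand-≡ e X ⟩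
    aliveTotal - ℕ→ℚ (cap e) ≤⟨ rearrange onPathCount onPathOpt (ℕ→ℚ (cap e)) onPathCount-covered split ⟩
    sumOf (aliveOpt e) X     ∎
    where
    open ≤-Reasoning
    onPathCount  = sumOf (onPath e ∘ skeleton) X
    onPathOpt    = sumOf (optOnPath e ∘ skeleton) X
    aliveTotal   = sumOf (aliveCount e) X
    onPathCount-covered : onPathCount - ℕ→ℚ (cap e) ≤ onPathOpt
    onPathCount-covered = subst₂ (λ A B → A - ℕ→ℚ (cap e) ≤ B)
      (sumOf-map (onPath e) skeleton X) (sumOf-map (optOnPath e) skeleton X) (covered e)
    split : onPathOpt ≤ sumOf (aliveOpt e) X + (onPathCount - aliveTotal)
    split = subst (onPathOpt ≤_)
      (trans (sumOf-+ (aliveOpt e) _ X) (cong (sumOf (aliveOpt e) X +_) (sumOf-- (onPath e ∘ skeleton) (aliveCount e) X)))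
      (sumOf-mono (All.map (λ {x} → optOnPath-≤ e x) sane))
    rearrange : ∀ {D V} A B c → A - c ≤ B → B ≤ D + (A - V) → V - c ≤ D
    rearrange {D} {V} A B c A-c≤B B≤D+A-V =
      subst₂ _≤_ (lhs A c V) (rhs D A V) (+-monoˡ-≤ (V - A) (≤-trans A-c≤B B≤D+A-V))
      where
      lhs : ∀ A c V → A - c + (V - A) ≡ V - c
      lhs = solve-∀ ℚ-ring
      rhs : ∀ D A V → D + (A - V) + (V - A) ≡ D
      rhs = solve-∀ ℚ-ring

  alive⇒weight<1 : ∀ e x → alive e x ≡ true → weight x < 1ℚ
  alive⇒weight<1 e x = from-test (e ∈ᵇ path (request x)) (weight x <? 1ℚ)
    where
    from-test : ∀ b (d : Dec (weight x < 1ℚ)) → b ∧ does d ≡ true → weight x < 1ℚ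
    from-test b     (yes w<1) _ = w<1
    from-test true  (no _)    ()
    from-test false (no _)    ()

  -- a violated edge has n_e ≥ 1, since 0 ≤ Σ_{ALIVE_e} f_i < n_e ∈ ℤ
  violated⇒demand≥1 : ∀ e X → All Sane X → Violated cap e (map erase X) → 1ℚ ≤ demand e X
  violated⇒demand≥1 e X sane violated = ℤ→ℚ-pos⇒≥1 (nₑ cap e (map erase X))
    (≤-<-trans (sumℚ-nonNeg (All.map⁺ (All.filter⁺ (T? ∘ aliveᵇ e) (All.map⁺ (All.map Sane.weight≥0 sane))))) violated)

  module _ (n : ℚ) (x : Ghost) (n≥1 : 1ℚ ≤ n) (sx : Sane x) where
    private
      np≥1 : 1ℚ ≤ n * cost (request x)
      np≥1 = *-mono-≤ 0≤1 (≤-trans 0≤1 (Sane.cost≥1 sx)) n≥1 (Sane.cost≥1 sx)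
      np>0 : 0ℚ < n * cost (request x)
      np>0 = ≥1⇒>0 np≥1

    increment≥0 : 0ℚ ≤ increment n x
    increment≥0 = <⇒≤ (inv-pos _ np>0)

    increment≤1 : increment n x ≤ 1ℚ
    increment≤1 = inv-≤1 _ np≥1

    increment-inverse : increment n x * (n * cost (request x)) ≡ 1ℚ
    increment-inverse = inv-inverse _ np>0

  module Analysis (w₀>0 : 0ℚ < w₀) (w₀≤1 : w₀ ≤ 1ℚ) where

    record Seeded (s t : ℚ) : Set where
      field
        seed≥0      : 0ℚ ≤ s
        seed≤1      : s ≤ 1ℚ
        seed-tracks : Dominates w₀ s t

    seeded : ∀ x → weight x < 1ℚ → Sane x → Seeded (seed x) (growth x)
    seeded x w<1 sx = by-cases (weight x ≟ 0ℚ) (Sane.tracked sx)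
      where
      by-cases : (d : Dec (weight x ≡ 0ℚ)) → (weight x ≡ 0ℚ × growth x ≡ 0ℚ) ⊎ Dominates w₀ (weight x) (growth x) →
        Seeded (if does d then w₀ else weight x) (growth x)
      by-cases (yes _)   (inj₁ (_ , t≡0)) = record { seed≥0 = <⇒≤ w₀>0 ; seed≤1 = w₀≤1
                                                 ; seed-tracks = subst (Dominates w₀ w₀) (sym t≡0) (dominates-start (<⇒≤ w₀>0)) }
      by-cases (yes w≡0) (inj₂ dom)        = record { seed≥0 = <⇒≤ w₀>0 ; seed≤1 = w₀≤1
                                                 ; seed-tracks = dominates-mono (subst (_≤ w₀) (sym w≡0) (<⇒≤ w₀>0)) dom }
      by-cases (no w≢0)  (inj₁ (w≡0 , _)) = ⊥-elim (w≢0 w≡0)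
      by-cases (no _)    (inj₂ dom)        = record { seed≥0 = Sane.weight≥0 sx ; seed≤1 = <⇒≤ w<1 ; seed-tracks = dom }

    -- an alive request stays sane when augmented: its new weight
    -- seed·(1 + y) ≤ 2 still dominates h at its new growth, by dominates-step
    sane-bump : ∀ n x → 1ℚ ≤ n → weight x < 1ℚ → Sane x → Sane (bumpIf true n x)
    sane-bump n x n≥1 w<1 sx = record
      { cost≥1   = Sane.cost≥1 sx
      ; opt≥0    = Sane.opt≥0 sx
      ; opt≤1    = Sane.opt≤1 sx
      ; weight≥0 = *-nonNeg (Seeded.seed≥0 s) (+-nonNeg 0≤1 y≥0)
      ; weight≤2 = subst (seed x * (1ℚ + y) ≤_) (*-identityˡ 2ℚ)
                     (*-mono-≤ (Seeded.seed≥0 s) 0≤2 (Seeded.seed≤1 s) (+-monoʳ-≤ 1ℚ (increment≤1 n x n≥1 sx)))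
      ; growth≥0 = +-nonNeg (Sane.growth≥0 sx) y≥0
      ; tracked  = inj₂ (dominates-step (<⇒≤ w₀>0) (Sane.growth≥0 sx) y≥0 (increment≤1 n x n≥1 sx) (Seeded.seed-tracks s))
      }
      where
      s = seeded x w<1 sx
      y = increment n x
      y≥0 = increment≥0 n x n≥1 sx

    sane-bumpIf : ∀ e n x → 1ℚ ≤ n → Sane x → Sane (bumpIf (alive e x) n x)
    sane-bumpIf e n x n≥1 sx = by-test (alive e x) refl
      where
      by-test : ∀ b → alive e x ≡ b → Sane (bumpIf b n x)
      by-test true  is-alive = sane-bump n x n≥1 (alive⇒weight<1 e x is-alive) sx
      by-test false _        = sx

    gain-scaled : ∀ e n x → 1ℚ ≤ n → Sane x → gain e n x * n ≡ aliveOpt e x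
    gain-scaled e n x n≥1 sx = by-test (alive e x)
      where
      regroup : ∀ φ p y n → φ * p * y * n ≡ φ * (y * (n * p))
      regroup = solve-∀ ℚ-ring
      by-test : ∀ b → (if b then opt x * cost (request x) * increment n x else 0ℚ) * n ≡ (if b then opt x else 0ℚ)
      by-test false = *-zeroˡ n
      by-test true  = trans (regroup (opt x) (cost (request x)) (increment n x) n)
                        (trans (cong (opt x *_) (increment-inverse n x n≥1 sx)) (*-identityʳ (opt x)))

    sane-augment : ∀ e X → Violated cap e (map erase X) → All Sane X → All Sane (augmentGhosts e X)
    sane-augment e X violated sane =
      All.map⁺ (All.map (λ {x} → sane-bumpIf e (demand e X) x (violated⇒demand≥1 e X sane violated)) sane)

    Ψ-augment≥ : ∀ e X → Violated cap e (map erase X) → All Sane X → Covers (map skeleton X) → Ψ X + 1ℚ ≤ Ψ (augmentGhosts e X)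
    Ψ-augment≥ e X violated sane covered =
      subst (Ψ X + 1ℚ ≤_) (sym (Ψ-augment e X)) (+-monoʳ-≤ (Ψ X) total-gain≥1)
      where
      n = demand e X
      n≥1 = violated⇒demand≥1 e X sane violated
      total-gain≥1 : 1ℚ ≤ sumOf (gain e n) X
      total-gain≥1 = *-cancelʳ-≤-pos n {{positive (≥1⇒>0 n≥1)}} (begin
        1ℚ * n                     ≡⟨ *-identityˡ n ⟩
        n                          ≤⟨ demand≤aliveOpt e X covered sane ⟩
        sumOf (aliveOpt e) X       ≡⟨ sumOf-cong (All.map (λ {x} → gain-scaled e n x n≥1) sane) ⟨
        sumOf (λ x → gain e n x * n) X ≡⟨ sumOf-*ʳ (gain e n) n X ⟨
        sumOf (gain e n) X * n     ∎)
        where open ≤-Reasoning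

    record Reached (X : List Ghost) (k : ℕ) (st : State G) : Set where
      constructor reached
      field
        ghosts        : List Ghost
        simulates     : st ≡ map erase ghosts
        all-sane      : All Sane ghosts
        same-skeleton : map skeleton ghosts ≡ map skeleton X
        Ψ-gain        : Ψ X + ℕ→ℚ k ≤ Ψ ghosts
    open Reached

    reached-here : ∀ X → All Sane X → Reached X 0 (map erase X)
    reached-here X sane = reached X refl sane refl (≤-reflexive (+-identityʳ (Ψ X)))

    reached-then : ∀ {X k l st st′} (first : Reached X k st) → Reached (ghosts first) l st′ → Reached X (k ℕ.+ l) st′
    reached-then {X} {k} {l} first next = reached (ghosts next) (simulates next) (all-sane next)
      (trans (same-skeleton next) (same-skeleton first)) (gains-add {a = Ψ X} k l (Ψ-gain first) (Ψ-gain next))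

    augmented : ∀ e X → Violated cap e (map erase X) → All Sane X → Covers (map skeleton X) →
      Reached X 1 (augment cap g e (map erase X))
    augmented e X violated sane covers = reached (augmentGhosts e X) (sym (erase-augment e X))
      (sane-augment e X violated sane) (skeleton-augment e X) (Ψ-augment≥ e X violated sane covers)

    edge-loop : ∀ {e st k st′} → EdgeLoop cap g e st k st′ →
      ∀ X → st ≡ map erase X → All Sane X → Covers (map skeleton X) → Reached X k st′
    edge-loop (stop _) X refl sane _ = reached-here X sane
    edge-loop {e} (step violated rest) X refl sane covers = reached-then once
      (edge-loop rest (ghosts once) (simulates once) (all-sane once) (subst Covers (sym (same-skeleton once)) covers))
      where
      once = augmented e X violated sane covers

    edges-loop : ∀ {es st k st′} → EdgesLoop cap g es st k st′ →
      ∀ X → st ≡ map erase X → All Sane X → Covers (map skeleton X) → Reached X k st′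
    edges-loop [] X refl sane _ = reached-here X sane
    edges-loop (loop ∷ loops) X simulated sane covers = reached-then first
      (edges-loop loops (ghosts first) (simulates first) (all-sane first) (subst Covers (sym (same-skeleton first)) covers))
      where
      first = edge-loop loop X simulated sane covers

    -- With w₀·2^K > 1, a sane request has total growth at most 2(K + 1):
    -- its weight is at most 2 and dominates w₀·h(growth).
    growth-bound : ∀ K → 1ℚ < w₀ * pow2 K → ∀ x → Sane x → growth x ≤ 2ℚ * ℕ→ℚ (suc K)
    growth-bound K big x sx = from-tracking (Sane.tracked sx)
      where
      from-tracking : (weight x ≡ 0ℚ × growth x ≡ 0ℚ) ⊎ Dominates w₀ (weight x) (growth x) → growth x ≤ 2ℚ * ℕ→ℚ (suc K)
      from-tracking (inj₁ (_ , t≡0)) = subst (_≤ 2ℚ * ℕ→ℚ (suc K)) (sym t≡0) (*-nonNeg 0≤2 (ℕ→ℚ-nonNeg (suc K)))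
      from-tracking (inj₂ dom)       = dominates-bound K dom (Sane.weight≤2 sx) big

    Ψ≤cost*T : ∀ K → 1ℚ < w₀ * pow2 K → ∀ X → All Sane X →
      Ψ X ≤ solCost (map request X) (map opt X) * (2ℚ * ℕ→ℚ (suc K))
    Ψ≤cost*T K big X sane = begin
      Ψ X                                              ≤⟨ sumOf-mono (All.map (λ {x} → potential≤ x) sane) ⟩
      sumOf (λ x → opt x * cost (request x) * T) X     ≡⟨ sumOf-*ʳ (λ x → opt x * cost (request x)) T X ⟨
      sumOf (λ x → opt x * cost (request x)) X * T     ≡⟨ cong (_* T) (solCost-ghosts X) ⟨
      solCost (map request X) (map opt X) * T          ∎
      where
      open ≤-Reasoning
      T = 2ℚ * ℕ→ℚ (suc K)
      potential≤ : ∀ x → Sane x → potential x ≤ opt x * cost (request x) * T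
      potential≤ x sx = *-monoˡ-≤ (*-nonNeg (Sane.opt≥0 sx) (≤-trans 0≤1 (Sane.cost≥1 sx))) (growth-bound K big x sx)

    module Runs (rs₀ : List (Request G)) (fstar : List ℚ) (feasible : Feasible cap rs₀ fstar) where

      record Pending (X : List Ghost) (rs : List (Request G)) (fs : List ℚ) : Set where
        field
          requests-split : map request X ++ rs ≡ rs₀
          opts-split     : map opt X ++ fs ≡ fstar
          aligned        : length fs ≡ length rs
          unit           : AllUnit fs
          costs≥1        : All (λ r → 1ℚ ≤ cost r) rs
      open Pending

      pending-skeleton : ∀ {X Y rs fs} → map skeleton Y ≡ map skeleton X → Pending X rs fs → Pending Y rs fs
      pending-skeleton {X} {Y} same pending = record
        { requests-split = trans (cong (_++ _) (along proj₁)) (requests-split pending)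
        ; opts-split     = trans (cong (_++ _) (along proj₂)) (opts-split pending)
        ; aligned        = aligned pending
        ; unit           = unit pending
        ; costs≥1        = costs≥1 pending }
        where
        along : ∀ {A : Set} (f : Request G × ℚ → A) → map (f ∘ skeleton) Y ≡ map (f ∘ skeleton) X
        along f = trans (List.map-∘ Y) (trans (cong (map f) same) (sym (List.map-∘ X)))

      reqCount-++ : ∀ e X rs → ℕ→ℚ (reqCount e (map request X ++ rs)) ≡ sumOf (onPath e) (map skeleton X) + ℕ→ℚ (reqCount e rs)
      reqCount-++ e []      rs = sym (+-identityˡ (ℕ→ℚ (reqCount e rs)))
      reqCount-++ e (x ∷ X) rs = begin
        ℕ→ℚ (onE ℕ.+ reqCount e (map request X ++ rs))      ≡⟨ ℕ→ℚ-+ onE _ ⟩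
        ℕ→ℚ onE + ℕ→ℚ (reqCount e (map request X ++ rs))    ≡⟨ cong₂ _+_ (if-float ℕ→ℚ (e ∈ᵇ path (request x))) (reqCount-++ e X rs) ⟩
        onPath e (skeleton x) + (sumOf (onPath e) (map skeleton X) + ℕ→ℚ (reqCount e rs))
                                                            ≡⟨ +-assoc (onPath e (skeleton x)) _ _ ⟨
        sumOf (onPath e) (map skeleton (x ∷ X)) + ℕ→ℚ (reqCount e rs) ∎
        where
        open ≡-Reasoning
        onE = if e ∈ᵇ path (request x) then 1 else 0

      reqSum-++ : ∀ e X rs fs → reqSum e (map request X ++ rs) (map opt X ++ fs) ≡ sumOf (optOnPath e) (map skeleton X) + reqSum e rs fs
      reqSum-++ e []      rs fs = sym (+-identityˡ (reqSum e rs fs))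
      reqSum-++ e (x ∷ X) rs fs = trans (cong ((optOnPath e (skeleton x)) +_) (reqSum-++ e X rs fs))
        (sym (+-assoc (optOnPath e (skeleton x)) _ _))

      -- the requests present are covered, since the pending ones take at most
      -- one unit each: f* restricted to a prefix is feasible for the prefix
      pending⇒covers : ∀ {X rs fs} → Pending X rs fs → Covers (map skeleton X)
      pending⇒covers {X} {rs} {fs} pending e = begin
        A - c                        ≡⟨ cancel A R c ⟨
        A + R - c - R                ≤⟨ +-monoˡ-≤ (- R) whole ⟩
        B + R - R                    ≡⟨ cancel′ B R ⟩
        B                            ∎
        where
        open ≤-Reasoning
        A = sumOf (onPath e) (map skeleton X)
        B = sumOf (optOnPath e) (map skeleton X)
        R = ℕ→ℚ (reqCount e rs)
        c = ℕ→ℚ (cap e)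
        cancel : ∀ A R c → A + R - c - R ≡ A - c
        cancel = solve-∀ ℚ-ring
        cancel′ : ∀ B R → B + R - R ≡ B
        cancel′ = solve-∀ ℚ-ring
        whole : A + R - c ≤ B + R
        whole = begin
          A + R - c                                              ≡⟨ cong (_- c) (reqCount-++ e X rs) ⟨
          ℕ→ℚ (reqCount e (map request X ++ rs)) - c             ≡⟨ cong (λ rs′ → ℕ→ℚ (reqCount e rs′) - c) (requests-split pending) ⟩
          ℕ→ℚ (reqCount e rs₀) - c                               ≡⟨ ℕ→ℚ-minus (reqCount e rs₀) (cap e) ⟨
          ℤ→ℚ ((ℤ.+ reqCount e rs₀) ℤ.- (ℤ.+ cap e))             ≤⟨ proj₂ (proj₂ feasible) e ⟩
          reqSum e rs₀ fstar                                     ≡⟨ cong₂ (reqSum e) (requests-split pending) (opts-split pending) ⟨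
          reqSum e (map request X ++ rs) (map opt X ++ fs)       ≡⟨ reqSum-++ e X rs fs ⟩
          B + reqSum e rs fs                                     ≤⟨ +-monoʳ-≤ B (reqSum≤reqCount {G} e rs fs (unit pending)) ⟩
          B + R                                                  ∎

      newcomer : Request G → ℚ → Ghost
      newcomer r f = ghost r 0ℚ 0ℚ f

      Ψ-arrive : ∀ X r f → Ψ (X ++ [ newcomer r f ]) ≡ Ψ X
      Ψ-arrive X r f = trans (sumOf-++ potential X [ newcomer r f ])
        (trans (cong (Ψ X +_) (trans (+-identityʳ _) (*-zeroʳ (f * cost r)))) (+-identityʳ (Ψ X)))

      pending-arrive : ∀ X r rs f fs → Pending X (r ∷ rs) (f ∷ fs) → Pending (X ++ [ newcomer r f ]) rs fs
      pending-arrive X r rs f fs pending = record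
        { requests-split = trans (cong (_++ rs) (List.map-++ request X [ newcomer r f ]))
                             (trans (List.++-assoc (map request X) [ r ] rs) (requests-split pending))
        ; opts-split     = trans (cong (_++ fs) (List.map-++ opt X [ newcomer r f ]))
                             (trans (List.++-assoc (map opt X) [ f ] fs) (opts-split pending))
        ; aligned        = ℕ.suc-injective (aligned pending)
        ; unit           = AllUnit-tail (unit pending)
        ; costs≥1        = All.tail (costs≥1 pending) }
        where
        AllUnit-tail : AllUnit (f ∷ fs) → AllUnit fs
        AllUnit-tail (_ ∷ unit) = unit

      sane-newcomer : ∀ {X r rs f fs} → Pending X (r ∷ rs) (f ∷ fs) → Sane (newcomer r f)
      sane-newcomer pending with unit pending | costs≥1 pending
      ... | (f≥0 , f≤1) ∷ _ | cost≥1 ∷ _ = record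
        { cost≥1 = cost≥1 ; opt≥0 = f≥0 ; opt≤1 = f≤1 ; weight≥0 = ≤-refl ; weight≤2 = 0≤2
        ; growth≥0 = ≤-refl ; tracked = inj₁ (refl , refl) }

      record Finished (X : List Ghost) (k : ℕ) : Set where
        constructor finished
        field
          final-ghosts : List Ghost
          final-sane   : All Sane final-ghosts
          complete     : Pending final-ghosts [] []
          final-gain   : Ψ X + ℕ→ℚ k ≤ Ψ final-ghosts
      open Finished

      run-finishes : ∀ {rs st k st′} → Run cap g rs st k st′ →
        ∀ X fs → st ≡ map erase X → All Sane X → Pending X rs fs → Finished X k
      run-finishes [] X [] _ sane pending = finished X sane pending (≤-reflexive (+-identityʳ (Ψ X)))
      run-finishes [] X (_ ∷ _) _ _ pending with aligned pending
      ... | ()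
      run-finishes (arrive _ _ _) X [] _ _ pending with aligned pending
      ... | ()
      run-finishes (arrive {r = r} {rs = rs} {k = k} {l = l} _ loops rest) X (f ∷ fs) refl sane pending =
        finished (final-ghosts done) (final-sane done) (complete done)
          (gains-add {a = Ψ X} k l (subst (λ a → a + ℕ→ℚ k ≤ Ψ (ghosts edges)) (Ψ-arrive X r f) (Ψ-gain edges)) (final-gain done))
        where
        X₁ = X ++ [ newcomer r f ]
        pending₁ = pending-arrive X r rs f fs pending
        edges = edges-loop loops X₁ (sym (List.map-++ erase X [ newcomer r f ]))
                  (All.++⁺ sane (sane-newcomer pending ∷ [])) (pending⇒covers pending₁)
        done = run-finishes rest (ghosts edges) fs (simulates edges) (all-sane edges)
                 (pending-skeleton (same-skeleton edges) pending₁)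

      augmentations-bound : ∀ K → 1ℚ < w₀ * pow2 K → All (λ r → 1ℚ ≤ cost r) rs₀ →
        ∀ {k st} → Run cap g rs₀ [] k st → ℕ→ℚ k ≤ solCost rs₀ fstar * (2ℚ * ℕ→ℚ (suc K))
      augmentations-bound K big costs {k} run = begin
        ℕ→ℚ k                                         ≡⟨ +-identityˡ (ℕ→ℚ k) ⟨
        Ψ [] + ℕ→ℚ k                                  ≤⟨ final-gain done ⟩
        Ψ X                                           ≤⟨ Ψ≤cost*T K big X (final-sane done) ⟩
        solCost (map request X) (map opt X) * T       ≡⟨ cong₂ (λ rs fs → solCost rs fs * T) (whole requests-split) (whole opts-split) ⟩
        solCost rs₀ fstar * T                         ∎
        where
        open ≤-Reasoning
        T = 2ℚ * ℕ→ℚ (suc K)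
        initially : Pending [] rs₀ fstar
        initially = record { requests-split = refl ; opts-split = refl ; aligned = proj₁ feasible
                       ; unit = proj₁ (proj₂ feasible) ; costs≥1 = costs }
        done = run-finishes run [] fstar refl [] initially
        X = final-ghosts done
        whole : ∀ {A : Set} {xs ys : List A} → (Pending X [] [] → xs ++ [] ≡ ys) → xs ≡ ys
        whole {xs = xs} split = trans (sym (List.++-identityʳ xs)) (split (complete done))

no-edges⇒no-augmentations : ∀ {G cap g rs st k st′} → (Fin (m G) → ⊥) → Run {G} cap g rs st k st′ → k ≡ 0
no-edges⇒no-augmentations none []                                   = refl
no-edges⇒no-augmentations none (arrive _ [] rest)                   = no-edges⇒no-augmentations none rest
no-edges⇒no-augmentations none (arrive _ (_∷_ {e = e} _ _) _)       = ⊥-elim (none e)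

maxCap-≥ : ∀ G (cap : Fin (m G) → ℕ) e → cap e ℕ.≤ maxCap G cap
maxCap-≥ G cap e = below-fold (List.allFin (m G)) (∈-allFin e)
  where
  below-fold : ∀ es → e ∈ es → cap e ℕ.≤ List.foldr (λ e′ acc → cap e′ ℕ.⊔ acc) 0 es
  below-fold (_ ∷ es) (here refl) = ℕ.m≤m⊔n (cap e) _
  below-fold (e′ ∷ es) (there e∈es) = ℕ.≤-trans (below-fold es e∈es) (ℕ.m≤n⊔m (cap e′) _)

edge-or-none : ∀ n → (Fin n → ⊥) ⊎ Fin n
edge-or-none zero    = inj₁ λ ()
edge-or-none (suc n) = inj₂ Fin.zero

T≤4L : ∀ a n → 0ℚ ≤ a → a * (2ℚ * ℕ→ℚ (suc (suc n))) ≤ ℕ→ℚ 4 * a * ℕ→ℚ (suc n)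
T≤4L a n a≥0 = ≤-by-gap (a * (2ℚ * ℕ→ℚ (suc (suc n)))) (ℕ→ℚ 4 * a * ℕ→ℚ (suc n))
  (trans (cong₂ (λ l l′ → (2ℚ * 2ℚ) * a * l - a * (2ℚ * l′)) (ℕ→ℚ-suc n) ℕ→ℚ-2+n) (gap a (ℕ→ℚ n)))
  (*-nonNeg (*-nonNeg 0≤2 a≥0) (ℕ→ℚ-nonNeg n))
  where
  ℕ→ℚ-2+n : ℕ→ℚ (suc (suc n)) ≡ 1ℚ + (1ℚ + ℕ→ℚ n)
  ℕ→ℚ-2+n = trans (ℕ→ℚ-suc (suc n)) (cong (1ℚ +_) (ℕ→ℚ-suc n))
  gap : ∀ a l → (2ℚ * 2ℚ) * a * (1ℚ + l) - a * (2ℚ * (1ℚ + (1ℚ + l))) ≡ 2ℚ * a * l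
  gap = solve-∀ ℚ-ring

-- The analysis applied to an instance with an edge e and a request of cost
-- p ∈ [1, g]: then g·c ≥ 1, so w₀ = 1/(gc) ∈ (0,1] and w₀·2^L > 1.
augmentations-bound-with-edge : ∀ {G} (cap : Fin (m G) → ℕ) g (e : Fin (m G)) → cap e > 0 →
  ∀ {p} → 1ℚ ≤ p → p ≤ g → ∀ rs fstar → Feasible cap rs fstar → All (λ r → 1ℚ ≤ cost r) rs →
  ∀ {k st} → Run cap g rs [] k st →
  ℕ→ℚ k ≤ solCost rs fstar * (2ℚ * ℕ→ℚ (suc (logFactor g (maxCap G cap))))
augmentations-bound-with-edge {G} cap g e cap[e]>0 p≥1 p≤g rs fstar feasible costs run =
  augmentations-bound (logFactor g c) w₀2^L>1 costs run
  where
  open Simulation G cap g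
  c = maxCap G cap
  gc≥1 : 1ℚ ≤ g * ℕ→ℚ c
  gc≥1 = *-mono-≤ 0≤1 (ℕ→ℚ-nonNeg c) (≤-trans p≥1 p≤g) (ℕ→ℚ-mono-≤ (ℕ.≤-trans cap[e]>0 (maxCap-≥ G cap e)))
  w₀>0 : 0ℚ < w₀
  w₀>0 = inv-pos (g * ℕ→ℚ c) (≥1⇒>0 gc≥1)
  w₀2^L>1 : 1ℚ < w₀ * pow2 (logFactor g c)
  w₀2^L>1 = subst (_< w₀ * pow2 (logFactor g c)) (inv-inverse (g * ℕ→ℚ c) (≥1⇒>0 gc≥1))
              (*-monoʳ-<-pos w₀ {{positive w₀>0}} (<2^logFactor g c (<⇒≤ (≥1⇒>0 gc≥1))))
  open Analysis w₀>0 (inv-≤1 (g * ℕ→ℚ c) gc≥1)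
  open Runs rs fstar feasible

-- The theorem with the constant C = 4.  Without edges nothing is augmented;
-- otherwise the analysis gives k ≤ α·2(L + 1) ≤ 4·α·L.
augmentations≤4αL : (G : Graph) (cap : Fin (m G) → ℕ) → (∀ e → cap e > 0) →
  (g : ℚ) (rs : List (Request G)) →
  All (λ r → SimplePath G (path r)) rs →
  All (λ r → (1ℚ ≤ cost r) × (cost r ≤ g)) rs →
  (fstar : List ℚ) → Optimal cap rs fstar →
  0ℚ < solCost rs fstar →
  (k : ℕ) (final : State G) → Run cap g rs [] k final →
  ℕ→ℚ k ≤ ℕ→ℚ 4 * solCost rs fstar * ℕ→ℚ (logFactor g (maxCap G cap))
augmentations≤4αL G cap _ g [] _ _ fstar _ α>0 k _ _ = ⊥-elim (<-irrefl refl α>0)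
augmentations≤4αL G cap cap>0 g rs@(_ ∷ _) _ costs@((p≥1 , p≤g) ∷ _) fstar (feasible , _) α>0 k _ run =
  by-edges (edge-or-none (m G))
  where
  α = solCost rs fstar
  L = logFactor g (maxCap G cap)
  ⌊log₂gc⌋ = ⌊log₂ (ℤ.∣_∣ (ℚ.ceiling (g * ℕ→ℚ (maxCap G cap)))) ⌋
  by-edges : (Fin (m G) → ⊥) ⊎ Fin (m G) → ℕ→ℚ k ≤ ℕ→ℚ 4 * α * ℕ→ℚ L
  by-edges (inj₁ none) = subst (λ j → ℕ→ℚ j ≤ ℕ→ℚ 4 * α * ℕ→ℚ L) (sym (no-edges⇒no-augmentations none run))
                           (*-nonNeg (*-nonNeg (ℕ→ℚ-nonNeg 4) (<⇒≤ α>0)) (ℕ→ℚ-nonNeg L))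
  by-edges (inj₂ e) = ≤-trans
    (augmentations-bound-with-edge cap g e (cap>0 e) p≥1 p≤g rs fstar feasible (All.map proj₁ costs) run)
    (T≤4L α ⌊log₂gc⌋ (<⇒≤ α>0))

lemma1 : Σ ℕ λ C →
    (G : Graph) (cap : Fin (m G) → ℕ) → (∀ e → cap e > 0) →
    (g : ℚ) (rs : List (Request G)) →
    All (λ r → SimplePath G (path r)) rs →
    All (λ r → (1ℚ ≤ cost r) × (cost r ≤ g)) rs →
    (fstar : List ℚ) → Optimal cap rs fstar →
    0ℚ < solCost rs fstar →
    (k : ℕ) (final : State G) → Run cap g rs [] k final →
    ℕ→ℚ k ≤ ℕ→ℚ C * solCost rs fstar * ℕ→ℚ (logFactor g (maxCap G cap))
lemma1 = 4 , augmentations≤4αL
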